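{- If $G$ is a bipartite graph with bipartition $V(G)=V_1\cup V_2$ and $G$ has no isolated vertices, then $\chi_i'(G)\le \min\{|V_1|,|V_2|\}$.
   Context: All graphs are finite and simple. Three edges $e_1,e_2,e_3$ (in this order) are consecutive if $e_1=xy$, $e_2=yz$, $e_3=zu$ for some vertices $x,y,z,u$ (where $x=u$ is allowed). An injective edge coloring of $G$ is a map $c:E(G)\to\mathcal{C}$ such that whenever $e_1,e_2,e_3$ are consecutive edges, $c(e_1)\neq c(e_3)$. $\chi_i'(G)$ is the minimum number of colors in an injective edge coloring of $G$. -}

module Defs where

open import Data.Nat using (ℕ)
open import Data.Fin using (Fin)
open import Data.Bool using (Bool; true; false)
open import Data.Product using (Σ; ∃; _×_)
open import Data.List using (length; filter)
open import Data.List using () renaming (List to L)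
open import Data.Fin.Base using ()
open import Data.List.Base using ()
open import Relation.Binary.PropositionalEquality using (_≡_; _≢_; trans)
open import Relation.Nullary using (¬_)
open import Relation.Nullary.Decidable using ()
open import Data.Bool.Base using (not; if_then_else_)
open import Data.Fin.Properties using ()
open import Data.List using (allFin)

record Graph (n : ℕ) : Set where
  field
    adj   : Fin n → Fin n → Bool
    adj-sym : ∀ u v → adj u v ≡ adj v u
    loopless : ∀ v → adj v v ≡ false
open Graph public

record EdgeColoring {n : ℕ} (G : Graph n) (k : ℕ) : Set where
  field
    col   : (u v : Fin n) → adj G u v ≡ true → Fin k
    col-sym : ∀ u v (p : adj G u v ≡ true) →
              col u v p ≡ col v u (trans (Graph.adj-sym G v u) p)
open EdgeColoring public

-- Consecutive edges e1 = xy, e2 = yz, e3 = zu : three distinct edges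
-- (so x ≢ z and y ≢ u), forming a path or (when x = u) a triangle.
-- Injective: c(e1) ≠ c(e3) for all such triples.
IsInjective : ∀ {n k} {G : Graph n} → EdgeColoring G k → Set
IsInjective {n} {k} {G} c =
  ∀ (x y z u : Fin n)
    (p : adj G x y ≡ true) (q : adj G y z ≡ true) (r : adj G z u ≡ true) →
    x ≢ z → y ≢ u →
    col c x y p ≢ col c z u r

InjChromaticIndex≤ : ∀ {n} → Graph n → ℕ → Set
InjChromaticIndex≤ G k = Σ (EdgeColoring G k) IsInjective

-- A bipartition V = V₁ ∪ V₂ given by side : V → Bool
-- (V₁ = side⁻¹ false, V₂ = side⁻¹ true); every edge joins the two parts.
IsBipartition : ∀ {n} → Graph n → (Fin n → Bool) → Set
IsBipartition {n} G side =
  ∀ (u v : Fin n) → adj G u v ≡ true → ¬ (side u ≡ side v)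

sideSize : ∀ {n} → (Fin n → Bool) → Bool → ℕ
sideSize {n} side b = length (filter (λ v → side v Data.Bool.≟ b) (allFin n))

NoIsolatedVertices : ∀ {n} → Graph n → Set
NoIsolatedVertices {n} G = ∀ (v : Fin n) → ∃ λ u → adj G v u ≡ true

module Submission where

-- Fix a side b ∈ {V₁, V₂} of the bipartition and number the
-- vertices of that side injectively by Fin |V_b|.  Every edge has exactly
-- one end on side b; colour the edge by the number of that end.
-- For consecutive edges xy, yz, zu the vertices x, z lie on one side and
-- y, u on the other, so the side-b ends of xy and zu are either x and z,
-- or y and u.  Since xy, yz, zu are distinct edges, x ≢ z and y ≢ u, hence
-- the two ends differ and so do the colours.  This gives an injective
-- edge colouring with |V_b| colours for each b, in particular with
-- min{|V₁|, |V₂|} colours.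

open import Defs
open import Data.Nat using (ℕ; _⊓_)
open import Data.Nat.Properties using (⊓-sel)
open import Data.Fin using (Fin)
open import Data.Bool using (Bool; true; false; _≟_)
open import Data.Bool.Properties using (¬-not; not-injective)
open import Data.List using (allFin; filter)
open import Data.List.Relation.Unary.Any using (index)
open import Data.List.Membership.Propositional.Properties using (∈-filter⁺; ∈-allFin)
open import Data.List.Membership.Setoid.Properties using (index-injective)
open import Data.Product using (_,_)
open import Data.Sum using (_⊎_; inj₁; inj₂)
open import Data.Empty using (⊥-elim)
open import Relation.Nullary using (yes; no)
open import Relation.Binary.PropositionalEquality
  using (_≡_; _≢_; refl; sym; trans; cong; subst; setoid; ≢-sym)
open import Axiom.UniquenessOfIdentityProofs using (module Decidable⇒UIP)

differs-from-both : ∀ {x y b : Bool} → x ≢ y → x ≢ b → y ≡ b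
differs-from-both x≢y x≢b = not-injective (trans (sym (¬-not x≢y)) (¬-not x≢b))

differs-from-same : ∀ {x y z : Bool} → x ≢ y → y ≢ z → x ≡ z
differs-from-same x≢y y≢z = trans (¬-not x≢y) (sym (¬-not (≢-sym y≢z)))

module SideNumbering {n : ℕ} (side : Fin n → Bool) (b : Bool) where

  sideIndex : (v : Fin n) → side v ≡ b → Fin (sideSize side b)
  sideIndex v v∈b = index (∈-filter⁺ (λ w → side w ≟ b) (∈-allFin v) v∈b)

  sideIndex-cong : ∀ {v w} (v∈b : side v ≡ b) (w∈b : side w ≡ b) →
                   v ≡ w → sideIndex v v∈b ≡ sideIndex w w∈b
  sideIndex-cong {v} v∈b w∈b refl =
    cong (sideIndex v) (Decidable⇒UIP.≡-irrelevant _≟_ v∈b w∈b)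

  sideIndex-injective : ∀ {v w} (v∈b : side v ≡ b) (w∈b : side w ≡ b) →
                        sideIndex v v∈b ≡ sideIndex w w∈b → v ≡ w
  sideIndex-injective _ _ = index-injective (setoid (Fin n)) _ _

module SideEnd {n : ℕ} (G : Graph n) (side : Fin n → Bool)
               (bip : IsBipartition G side) (b : Bool) where

  sideEnd : Fin n → Fin n → Fin n
  sideEnd u v with side u ≟ b
  ... | yes _ = u
  ... | no  _ = v

  sideEnd-on : ∀ u v → side u ≡ b → sideEnd u v ≡ u
  sideEnd-on u v u∈b with side u ≟ b
  ... | yes _   = refl
  ... | no  u∉b = ⊥-elim (u∉b u∈b)

  sideEnd-off : ∀ u v → side u ≢ b → sideEnd u v ≡ v
  sideEnd-off u v u∉b with side u ≟ b
  ... | yes u∈b = ⊥-elim (u∉b u∈b)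
  ... | no  _   = refl

  -- Case distinction on the side of a vertex, independent of sideEnd's
  -- internal test so that it does not disturb goals mentioning sideEnd.
  onSide? : ∀ v → side v ≡ b ⊎ side v ≢ b
  onSide? v with side v ≟ b
  ... | yes v∈b = inj₁ v∈b
  ... | no  v∉b = inj₂ v∉b

  sideEnd-side : ∀ u v → adj G u v ≡ true → side (sideEnd u v) ≡ b
  sideEnd-side u v uv with side u ≟ b
  ... | yes u∈b = u∈b
  ... | no  u∉b = differs-from-both (bip u v uv) u∉b

  sideEnd-sym : ∀ u v → adj G u v ≡ true → sideEnd u v ≡ sideEnd v u
  sideEnd-sym u v uv with onSide? u
  ... | inj₁ u∈b = trans (sideEnd-on u v u∈b)
                         (sym (sideEnd-off v u (λ v∈b → bip u v uv (trans u∈b (sym v∈b)))))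
  ... | inj₂ u∉b = trans (sideEnd-off u v u∉b)
                         (sym (sideEnd-on v u (differs-from-both (bip u v uv) u∉b)))

  path-same-side : ∀ x y z → adj G x y ≡ true → adj G y z ≡ true → side x ≡ side z
  path-same-side x y z xy yz = differs-from-same (bip x y xy) (bip y z yz)

  -- For consecutive edges xy, yz, zu the side-b ends of xy and zu are
  -- x and z, or y and u, because x and z share a side.
  sideEnd-consecutive : ∀ x y z u → adj G x y ≡ true → adj G y z ≡ true →
                        sideEnd x y ≡ sideEnd z u → x ≡ z ⊎ y ≡ u
  sideEnd-consecutive x y z u xy yz same-end with onSide? x
  ... | inj₁ x∈b = inj₁ (trans (sym (sideEnd-on x y x∈b))
                               (trans same-end (sideEnd-on z u z∈b)))
    where
    z∈b : side z ≡ b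
    z∈b = trans (sym (path-same-side x y z xy yz)) x∈b
  ... | inj₂ x∉b = inj₂ (trans (sym (sideEnd-off x y x∉b))
                               (trans same-end (sideEnd-off z u z∉b)))
    where
    z∉b : side z ≢ b
    z∉b z∈b = x∉b (trans (path-same-side x y z xy yz) z∈b)

module SideColouring {n : ℕ} (G : Graph n) (side : Fin n → Bool)
                     (bip : IsBipartition G side) (b : Bool) where
  open SideNumbering side b
  open SideEnd G side bip b

  sideColouring : EdgeColoring G (sideSize side b)
  sideColouring = record
    { col     = λ u v uv → sideIndex (sideEnd u v) (sideEnd-side u v uv)
    ; col-sym = λ u v uv → sideIndex-cong _ _ (sideEnd-sym u v uv)
    }

  sideColouring-injective : IsInjective sideColouring
  sideColouring-injective x y z u xy yz _ x≢z y≢u same-colour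
    with sideEnd-consecutive x y z u xy yz
           (sideIndex-injective _ _ same-colour)
  ... | inj₁ x≡z = x≢z x≡z
  ... | inj₂ y≡u = y≢u y≡u

  injective-by-side : InjChromaticIndex≤ G (sideSize side b)
  injective-by-side = sideColouring , sideColouring-injective

open SideColouring using (injective-by-side)

proposition8 : ∀ (n : ℕ) (G : Graph n) (side : Fin n → Bool) →
    IsBipartition G side → NoIsolatedVertices G →
    InjChromaticIndex≤ G (sideSize side false ⊓ sideSize side true)
proposition8 n G side bip _ with ⊓-sel (sideSize side false) (sideSize side true)
... | inj₁ min≡V₁ = subst (InjChromaticIndex≤ G) (sym min≡V₁)
                          (injective-by-side G side bip false)
... | inj₂ min≡V₂ = subst (InjChromaticIndex≤ G) (sym min≡V₂)
                          (injective-by-side G side bip true)
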